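{- For any graph $G$, $\operatorname{th}_c(G)\le \operatorname{th}_c^{\times}(G)\le \left\lfloor \frac{(\operatorname{th}_c(G)+1)^2}{4}\right\rfloor$.
   Context: Graphs are finite and simple. In the game of Cops and Robbers, the cops first occupy a multiset $S$ of vertices, then the robber chooses a vertex; in each round every cop moves to an adjacent vertex or stays, then the robber does likewise; perfect information; capture occurs when a cop occupies the robber's vertex. $\operatorname{capt}(G;S)$ is the optimal-play number of rounds to capture with cops starting on $S$ ($\infty$ if capture cannot be guaranteed; $0$ if, e.g., every vertex is occupied). $\operatorname{capt}_k(G)=\min_{|S|=k}\operatorname{capt}(G;S)$. The cop throttling number is $\operatorname{th}_c(G)=\min_k\{k+\operatorname{capt}_k(G)\}$ and the product cop throttling number is $\operatorname{th}_c^{\times}(G)=\min_k\{k(1+\operatorname{capt}_k(G))\}$. -}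

module Defs where

open import Data.Nat using (ℕ; zero; suc; _+_; _*_; _≤_)
open import Data.Bool using (Bool; true; false)
open import Data.Fin using (Fin)
open import Data.Vec using (Vec; lookup)
open import Data.Vec.Membership.Propositional using (_∈_)
open import Data.Product using (Σ; ∃; _×_)
open import Data.Sum using (_⊎_)
open import Relation.Binary.PropositionalEquality using (_≡_)

record Graph : Set where
  field
    n     : ℕ
    adj   : Fin n → Fin n → Bool
    sym   : ∀ u v → adj u v ≡ adj v u
    irrefl : ∀ v → adj v v ≡ false

module _ (G : Graph) where
  open Graph G

  Step : Fin n → Fin n → Set
  Step u v = u ≡ v ⊎ adj u v ≡ true

  -- positions of k cops (a multiset of k vertices, as a vector)
  Cops : ℕ → Set
  Cops k = Vec (Fin n) k

  CopMove : ∀ {k} → Cops k → Cops k → Set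
  CopMove C C' = ∀ i → Step (lookup C i) (lookup C' i)

  -- CopsWin t C r : cops at C, robber at r, cops to move;
  -- the cops can guarantee capture within t further rounds.
  CopsWin : ∀ {k} → ℕ → Cops k → Fin n → Set
  CopsWin zero    C r = r ∈ C
  CopsWin (suc t) C r =
    r ∈ C ⊎ Σ (Cops _) λ C' → CopMove C C' ×
      (r ∈ C' ⊎ (∀ r' → Step r r' → CopsWin t C' r'))

  CaptWithin : ∀ {k} → Cops k → ℕ → Set
  CaptWithin S t = ∀ r → CopsWin t S r

  -- capt(G;S) = t  (finite value; capt(G;S) = ∞ iff no such t exists)
  IsCapt : ∀ {k} → Cops k → ℕ → Set
  IsCapt S t = CaptWithin S t × (∀ t' → CaptWithin S t' → t ≤ t')

  -- capt_k(G) = t  (minimum over all multisets S of size k)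
  IsCaptK : ℕ → ℕ → Set
  IsCaptK k t = (Σ (Cops k) λ S → IsCapt S t)
              × (∀ (S : Cops k) t' → IsCapt S t' → t ≤ t')

  -- th_c(G) = m  (minimum of k + capt_k(G) over k with capt_k(G) finite)
  IsThc : ℕ → Set
  IsThc m = (∃ λ k → ∃ λ t → IsCaptK k t × k + t ≡ m)
          × (∀ k t → IsCaptK k t → m ≤ k + t)

  -- th_c^×(G) = p  (minimum of k (1 + capt_k(G)))
  IsThcProd : ℕ → Set
  IsThcProd p = (∃ λ k → ∃ λ t → IsCaptK k t × k * (1 + t) ≡ p)
              × (∀ k t → IsCaptK k t → p ≤ k * (1 + t))

module Submission where

open import Defs
open import Data.Nat using (ℕ; zero; suc; NonZero; _+_; _*_; _≤_; _/_)
open import Data.Nat.Properties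
open import Data.Nat.DivMod using (m*n/n≡m; /-monoˡ-≤)
open import Data.Nat.Solver using (module +-*-Solver)
open import Data.Product using (_×_; _,_)
open import Data.Sum using (inj₁; inj₂)
open import Data.Empty using (⊥; ⊥-elim)
open import Data.Vec using ([])
open import Relation.Binary.PropositionalEquality using (_≡_; refl; sym; cong; subst; subst₂)
open +-*-Solver

-- If k cops capture in t rounds (k + t = th_c) and k′ cops in t′ rounds
-- (k′ (1 + t′) = th_c^×), then th_c ≤ k′ + t′ ≤ k′ (1 + t′) = th_c^×, and
-- th_c^× ≤ k (1 + t) ≤ (k + (1 + t))² / 4 = (th_c + 1)² / 4 by AM-GM.

module _ (G : Graph) where

  no-cops-never-capture : ∀ t r → CopsWin G {0} t [] r → ⊥
  no-cops-never-capture zero    r ()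
  no-cops-never-capture (suc t) r (inj₁ ())
  no-cops-never-capture (suc t) r (inj₂ ([] , _ , inj₁ ()))
  no-cops-never-capture (suc t) r (inj₂ ([] , _ , inj₂ escape)) =
    no-cops-never-capture t r (escape r (inj₁ refl))

  -- Zero cops capture only on the empty graph, where no round is needed.
  captK-zero-cops : ∀ t → IsCaptK G 0 t → t ≡ 0
  captK-zero-cops t (([] , within , minimal) , _) =
    n≤0⇒n≡0 (minimal 0 λ r → ⊥-elim (no-cops-never-capture t r (within r)))

  captK-sum≤product : ∀ k t → IsCaptK G k t → k + t ≤ k * (1 + t)
  captK-sum≤product zero        t capt = ≤-reflexive (captK-zero-cops t capt)
  captK-sum≤product k@(suc _) t _    =
    subst (k + t ≤_) (sym (*-suc k t)) (+-monoʳ-≤ k (m≤n*m t k))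

-- 4 a (a + d) + d² = (2a + d)²
am-gm-offset : ∀ a d → 4 * (a * (a + d)) ≤ (a + (a + d)) * (a + (a + d))
am-gm-offset a d =
  subst (4 * (a * (a + d)) ≤_)
    (solve 2 (λ a d → con 4 :* (a :* (a :+ d)) :+ d :* d
                    := (a :+ (a :+ d)) :* (a :+ (a :+ d))) refl a d)
    (m≤m+n (4 * (a * (a + d))) (d * d))

am-gm-≤ : ∀ {a b} → a ≤ b → 4 * (a * b) ≤ (a + b) * (a + b)
am-gm-≤ {a} a≤b with m≤n⇒∃[o]m+o≡n a≤b
... | d , refl = am-gm-offset a d

am-gm : ∀ a b → 4 * (a * b) ≤ (a + b) * (a + b)
am-gm a b with ≤-total a b
... | inj₁ a≤b = am-gm-≤ a≤b
... | inj₂ b≤a = subst₂ _≤_ (cong (4 *_) (*-comm b a)) (cong (λ s → s * s) (+-comm b a))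
                   (am-gm-≤ b≤a)

m*n≤o⇒m≤o/n : ∀ m n o .{{_ : NonZero n}} → m * n ≤ o → m ≤ o / n
m*n≤o⇒m≤o/n m n o m*n≤o = subst (_≤ o / n) (m*n/n≡m m n) (/-monoˡ-≤ n m*n≤o)

m*[1+n]≤[m+n+1]²/4 : ∀ m n → m * (1 + n) ≤ ((m + n + 1) * (m + n + 1)) / 4
m*[1+n]≤[m+n+1]²/4 m n =
  m*n≤o⇒m≤o/n (m * (1 + n)) 4 _
    (subst₂ _≤_ (*-comm 4 (m * (1 + n))) (cong (λ s → s * s) m+[1+n]≡m+n+1)
      (am-gm m (1 + n)))
  where
  m+[1+n]≡m+n+1 : m + (1 + n) ≡ m + n + 1
  m+[1+n]≡m+n+1 = solve 2 (λ m n → m :+ (con 1 :+ n) := m :+ n :+ con 1) refl m n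

proposition4p2 : (G : Graph) (m p : ℕ) → IsThc G m → IsThcProd G p →
    m ≤ p × p ≤ ((m + 1) * (m + 1)) / 4
proposition4p2 G _ _ ((k , t , capt , refl) , thc-minimal)
                     ((k′ , t′ , capt′ , refl) , thcProd-minimal) =
  ≤-trans (thc-minimal k′ t′ capt′) (captK-sum≤product G k′ t′ capt′) ,
  ≤-trans (thcProd-minimal k t capt) (m*[1+n]≤[m+n+1]²/4 k t)
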